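{- The relation $=_{\mathit{mfe}}$ on $\mathcal{SP}_A$, defined by $P=_{\mathit{mfe}}Q\iff \mathit{mfe}(P)=\mathit{mfe}(Q)$, is a congruence, i.e. an equivalence relation such that $P=_{\mathit{mfe}}P'$ and $Q=_{\mathit{mfe}}Q'$ imply $\neg P=_{\mathit{mfe}}\neg P'$, $P\mathbin{\wedge_\bullet}Q=_{\mathit{mfe}}P'\mathbin{\wedge_\bullet}Q'$ and $P\mathbin{\vee_\bullet}Q=_{\mathit{mfe}}P'\mathbin{\vee_\bullet}Q'$.
   Context: Let $A$ be a countable set of atoms. $\mathcal{SP}_A$: closed terms generated by $P::=\mathsf T\mid\mathsf F\mid a\mid \neg P\mid P\mathbin{\wedge_\bullet}P\mid P\mathbin{\vee_\bullet}P$ ($a\in A$). $\mathcal T_A$: $\mathsf T,\mathsf F\in\mathcal T_A$ and $(X\trianglelefteq a\trianglerighteq Y)\in\mathcal T_A$ for $X,Y\in\mathcal T_A$, $a\in A$. Leaf replacement $X[\mathsf T\mapsto Y,\mathsf F\mapsto Z]$ replaces every leaf $\mathsf T$ by $Y$ and every leaf $\mathsf F$ by $Z$; omitted replacements are identities. $\mathit{fe}(\mathsf T)=\mathsf T$, $\mathit{fe}(\mathsf F)=\mathsf F$, $\mathit{fe}(a)=\mathsf T\trianglelefteq a\trianglerighteq\mathsf F$, $\mathit{fe}(\neg P)=\mathit{fe}(P)[\mathsf T\mapsto\mathsf F,\mathsf F\mapsto\mathsf T]$, $\mathit{fe}(P\mathbin{\wedge_\bullet}Q)=\mathit{fe}(P)[\mathsf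 T\mapsto\mathit{fe}(Q),\mathsf F\mapsto\mathit{fe}(Q)[\mathsf T\mapsto\mathsf F]]$, $\mathit{fe}(P\mathbin{\vee_\bullet}Q)=\mathit{fe}(P)[\mathsf T\mapsto\mathit{fe}(Q)[\mathsf F\mapsto\mathsf T],\mathsf F\mapsto\mathit{fe}(Q)]$. For $a\in A$: $L_a(B)=R_a(B)=B$ for $B\in\{\mathsf T,\mathsf F\}$; $L_a(X\trianglelefteq b\trianglerighteq Y)=L_a(X)$ if $b=a$, else $L_a(X)\trianglelefteq b\trianglerighteq L_a(Y)$; $R_a(X\trianglelefteq b\trianglerighteq Y)=R_a(Y)$ if $b=a$, else $R_a(X)\trianglelefteq b\trianglerighteq R_a(Y)$. $m(B)=B$, $m(X\trianglelefteq a\trianglerighteq Y)=m(L_a(X))\trianglelefteq a\trianglerighteq m(R_a(Y))$. $\mathit{mfe}(P)=m(\mathit{fe}(P))$. -}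

module Defs where

open import Data.Nat using (ℕ)
import Data.Nat as ℕ
open import Data.Product using (_×_; _,_)
open import Relation.Nullary using (Dec; yes; no)
open import Relation.Binary.PropositionalEquality using (_≡_; cong)
open import Function.Definitions using (Injective)
open import Relation.Binary.Definitions using (DecidableEquality)
open import Relation.Binary.Structures using (IsEquivalence)

-- A countable set of atoms: a type A with an injection into ℕ.
module Atoms (A : Set) (code : A → ℕ) (code-inj : Injective _≡_ _≡_ code) where

  _≟A_ : DecidableEquality A
  a ≟A b with code a ℕ.≟ code b
  ... | yes p = yes (code-inj p)
  ... | no ¬p = no (λ e → ¬p (cong code e))

  data SP : Set where
    T F : SP
    atom : A → SP
    ¬ₛ_ : SP → SP
    _∧●_ : SP → SP → SP
    _∨●_ : SP → SP → SP

  -- evaluation trees T_A ;  node X a Y  stands for  X ⊴ a ⊵ Y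
  data Tree : Set where
    T F : Tree
    node : Tree → A → Tree → Tree

  _[T↦_,F↦_] : Tree → Tree → Tree → Tree
  T [T↦ Y ,F↦ Z ] = Y
  F [T↦ Y ,F↦ Z ] = Z
  node X a X' [T↦ Y ,F↦ Z ] = node (X [T↦ Y ,F↦ Z ]) a (X' [T↦ Y ,F↦ Z ])

  fe : SP → Tree
  fe T = T
  fe F = F
  fe (atom a) = node T a F
  fe (¬ₛ P) = fe P [T↦ F ,F↦ T ]
  fe (P ∧● Q) = fe P [T↦ fe Q ,F↦ (fe Q [T↦ F ,F↦ F ]) ]
  fe (P ∨● Q) = fe P [T↦ (fe Q [T↦ T ,F↦ T ]) ,F↦ fe Q ]

  L R : A → Tree → Tree
  L a T = T
  L a F = F
  L a (node X b Y) with b ≟A a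
  ... | yes _ = L a X
  ... | no _ = node (L a X) b (L a Y)
  R a T = T
  R a F = F
  R a (node X b Y) with b ≟A a
  ... | yes _ = R a Y
  ... | no _ = node (R a X) b (R a Y)

  -- m, defined by well-founded recursion via a size bound (L, R do not increase size)
  size : Tree → ℕ
  size T = 0
  size F = 0
  size (node X _ Y) = ℕ.suc (size X ℕ.+ size Y)

  m′ : ℕ → Tree → Tree
  m′ _ T = T
  m′ _ F = F
  m′ ℕ.zero (node X a Y) = node X a Y
  m′ (ℕ.suc n) (node X a Y) = node (m′ n (L a X)) a (m′ n (R a Y))

  m : Tree → Tree
  m X = m′ (size X) X

  mfe : SP → Tree
  mfe P = m (fe P)

  _=mfe_ : SP → SP → Set
  P =mfe Q = mfe P ≡ mfe Q

  IsCongruence : Set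
  IsCongruence =
    IsEquivalence _=mfe_ ×
    (∀ {P P' Q Q'} → P =mfe P' → Q =mfe Q' →
       ((¬ₛ P) =mfe (¬ₛ P')) × ((P ∧● Q) =mfe (P' ∧● Q')) × ((P ∨● Q) =mfe (P' ∨● Q')))

-- Pruning (L_a, R_a) of distinct atoms commutes, pruning is idempotent, it distributes over leaf
-- replacement, and it commutes with m. Hence m (m X [T↦ Y ,F↦ Z ]) and m (X [T↦ m Y ,F↦ m Z ])
-- both equal m (X [T↦ Y ,F↦ Z ]), so the latter depends only on m X, m Y and m Z. As fe of each
-- connective is a leaf replacement applied to the fe's of its arguments, =mfe is a congruence.
module Submission where

open import Defs
open import Data.Nat using (ℕ; suc; _+_; _≤_; z≤n; s≤s)
open import Data.Nat.Properties using (≤-trans; ≤-refl; m≤m+n; m≤n+m; +-mono-≤; m≤n⇒m≤1+n)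
open import Data.Product using (_,_)
open import Data.Empty using (⊥-elim)
open import Relation.Nullary using (Dec; yes; no; ¬_)
open import Relation.Binary.PropositionalEquality
open import Function.Definitions using (Injective)

module _ (A : Set) (code : A → ℕ) (code-inj : Injective _≡_ _≡_ code) where
  open Atoms A code code-inj
  open ≡-Reasoning

  data Side : Set where
    left right : Side

  branch : Side → Tree → Tree → Tree
  branch left  X Y = X
  branch right X Y = Y

  prune : Side → A → Tree → Tree
  prune s a T = T
  prune s a F = F
  prune s a (node X b Y) with b ≟A a
  ... | yes _ = branch s (prune s a X) (prune s a Y)
  ... | no _  = node (prune s a X) b (prune s a Y)

  L≡prune-left : ∀ a X → L a X ≡ prune left a X
  L≡prune-left a T = refl
  L≡prune-left a F = refl
  L≡prune-left a (node X b Y) with b ≟A a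
  ... | yes _ = L≡prune-left a X
  ... | no _  = cong₂ (λ U V → node U b V) (L≡prune-left a X) (L≡prune-left a Y)

  R≡prune-right : ∀ a X → R a X ≡ prune right a X
  R≡prune-right a T = refl
  R≡prune-right a F = refl
  R≡prune-right a (node X b Y) with b ≟A a
  ... | yes _ = R≡prune-right a Y
  ... | no _  = cong₂ (λ U V → node U b V) (R≡prune-right a X) (R≡prune-right a Y)

  prune-hit : ∀ s {a} X Y → prune s a (node X a Y) ≡ branch s (prune s a X) (prune s a Y)
  prune-hit s {a} X Y with a ≟A a
  ... | yes _  = refl
  ... | no a≢a = ⊥-elim (a≢a refl)

  prune-miss : ∀ s {a c} X Y → ¬ c ≡ a → prune s a (node X c Y) ≡ node (prune s a X) c (prune s a Y)
  prune-miss s {a} {c} X Y c≢a with c ≟A a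
  ... | yes c≡a = ⊥-elim (c≢a c≡a)
  ... | no _    = refl

  prune-comm : ∀ s t {a b} → ¬ a ≡ b → ∀ X → prune s a (prune t b X) ≡ prune t b (prune s a X)
  prune-comm s t a≢b T = refl
  prune-comm s t a≢b F = refl
  prune-comm s t {a} {b} a≢b (node X c Y) with c ≟A a | c ≟A b
  ... | yes refl | yes refl = ⊥-elim (a≢b refl)
  prune-comm left  t a≢b (node X c Y) | yes refl | no _ = trans (prune-hit left _ _)  (prune-comm left t a≢b X)
  prune-comm right t a≢b (node X c Y) | yes refl | no _ = trans (prune-hit right _ _) (prune-comm right t a≢b Y)
  prune-comm s left  a≢b (node X c Y) | no _ | yes refl = trans (prune-comm s left a≢b X)  (sym (prune-hit left _ _))
  prune-comm s right a≢b (node X c Y) | no _ | yes refl = trans (prune-comm s right a≢b Y) (sym (prune-hit right _ _))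
  prune-comm s t {a} {b} a≢b (node X c Y) | no c≢a | no c≢b = begin
    prune s a (node (prune t b X) c (prune t b Y))             ≡⟨ prune-miss s _ _ c≢a ⟩
    node (prune s a (prune t b X)) c (prune s a (prune t b Y)) ≡⟨ cong₂ (λ U V → node U c V) (prune-comm s t a≢b X) (prune-comm s t a≢b Y) ⟩
    node (prune t b (prune s a X)) c (prune t b (prune s a Y)) ≡⟨ prune-miss t _ _ c≢b ⟨
    prune t b (node (prune s a X) c (prune s a Y))             ∎

  prune-idem : ∀ s a X → prune s a (prune s a X) ≡ prune s a X
  prune-idem s a T = refl
  prune-idem s a F = refl
  prune-idem s a (node X c Y) with c ≟A a
  prune-idem left  a (node X c Y) | yes _ = prune-idem left a X
  prune-idem right a (node X c Y) | yes _ = prune-idem right a Y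
  ... | no c≢a = trans (prune-miss s _ _ c≢a) (cong₂ (λ U V → node U c V) (prune-idem s a X) (prune-idem s a Y))

  prune-replace : ∀ s a X Y Z → prune s a (X [T↦ Y ,F↦ Z ]) ≡ prune s a X [T↦ prune s a Y ,F↦ prune s a Z ]
  prune-replace s a T Y Z = refl
  prune-replace s a F Y Z = refl
  prune-replace s a (node X c X') Y Z with c ≟A a
  prune-replace left  a (node X c X') Y Z | yes _ = prune-replace left a X Y Z
  prune-replace right a (node X c X') Y Z | yes _ = prune-replace right a X' Y Z
  ... | no _ = cong₂ (λ U V → node U c V) (prune-replace s a X Y Z) (prune-replace s a X' Y Z)

  size-prune : ∀ s a X → size (prune s a X) ≤ size X
  size-prune s a T = z≤n
  size-prune s a F = z≤n
  size-prune s a (node X c Y) with c ≟A a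
  size-prune left  a (node X c Y) | yes _ = m≤n⇒m≤1+n (≤-trans (size-prune left a X) (m≤m+n _ _))
  size-prune right a (node X c Y) | yes _ = m≤n⇒m≤1+n (≤-trans (size-prune right a Y) (m≤n+m _ _))
  ... | no _ = s≤s (+-mono-≤ (size-prune s a X) (size-prune s a Y))

  size-branch : ∀ s X Y → size (branch s X Y) ≤ size X + size Y
  size-branch left  X Y = m≤m+n (size X) (size Y)
  size-branch right X Y = m≤n+m (size Y) (size X)

  size-prune-branch : ∀ s a X Y {n} → size X + size Y ≤ n → size (prune s a (branch s X Y)) ≤ n
  size-prune-branch s a X Y p = ≤-trans (size-prune s a _) (≤-trans (size-branch s X Y) p)

  m′-stable : ∀ n k X → size X ≤ n → size X ≤ k → m′ n X ≡ m′ k X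
  m′-stable n k T p q = refl
  m′-stable n k F p q = refl
  m′-stable (suc n) (suc k) (node X a Y) (s≤s p) (s≤s q) =
    cong₂ (λ U V → node U a V) (m′-stable n k (L a X) (sizeL p) (sizeL q)) (m′-stable n k (R a Y) (sizeR p) (sizeR q))
    where
    sizeL : ∀ {n} → size X + size Y ≤ n → size (L a X) ≤ n
    sizeL p = subst (λ W → size W ≤ _) (sym (L≡prune-left a X)) (size-prune-branch left a X Y p)
    sizeR : ∀ {n} → size X + size Y ≤ n → size (R a Y) ≤ n
    sizeR p = subst (λ W → size W ≤ _) (sym (R≡prune-right a Y)) (size-prune-branch right a X Y p)

  m-node : ∀ X a Y → m (node X a Y) ≡ node (m (prune left a X)) a (m (prune right a Y))
  m-node X a Y rewrite L≡prune-left a X | R≡prune-right a Y = cong₂ (λ U V → node U a V)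
    (m′-stable _ _ (prune left a X) (size-prune-branch left a X Y ≤-refl) ≤-refl)
    (m′-stable _ _ (prune right a Y) (size-prune-branch right a X Y ≤-refl) ≤-refl)

  m-node-cong : ∀ U c V U' V' → m (prune left c U) ≡ m (prune left c U') → m (prune right c V) ≡ m (prune right c V') →
                m (node U c V) ≡ m (node U' c V')
  m-node-cong U c V U' V' eqˡ eqʳ = begin
    m (node U c V)                                      ≡⟨ m-node U c V ⟩
    node (m (prune left c U)) c (m (prune right c V))   ≡⟨ cong₂ (λ P Q → node P c Q) eqˡ eqʳ ⟩
    node (m (prune left c U')) c (m (prune right c V')) ≡⟨ m-node U' c V' ⟨
    m (node U' c V')                                    ∎

  prune-m-comm-≤ : ∀ s a n X → size X ≤ n → prune s a (m X) ≡ m (prune s a X)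
  prune-m-comm-≤ s a n T p = refl
  prune-m-comm-≤ s a n F p = refl
  prune-m-comm-≤ s a (suc n) (node X c Y) (s≤s p) = by-cases (c ≟A a)
    -- not `with c ≟A a`: that would also abstract the test hidden in the unfolding of m (node X c Y)
    where
    by-cases : Dec (c ≡ a) → prune s a (m (node X c Y)) ≡ m (prune s a (node X c Y))
    by-cases (yes refl) = begin
      prune s c (m (node X c Y))                                    ≡⟨ cong (prune s c) (m-node X c Y) ⟩
      prune s c (node (m (prune left c X)) c (m (prune right c Y))) ≡⟨ prune-hit s _ _ ⟩
      branch s (prune s c (m (prune left c X))) (prune s c (m (prune right c Y))) ≡⟨ selected s ⟩
      m (branch s (prune s c X) (prune s c Y))                      ≡⟨ cong m (prune-hit s X Y) ⟨
      m (prune s c (node X c Y))                                    ∎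
      where
      pruned-fixed : ∀ t W → size (prune t c W) ≤ n → prune t c (m (prune t c W)) ≡ m (prune t c W)
      pruned-fixed t W q = trans (prune-m-comm-≤ t c n (prune t c W) q) (cong m (prune-idem t c W))
      selected : ∀ t → branch t (prune t c (m (prune left c X))) (prune t c (m (prune right c Y)))
                     ≡ m (branch t (prune t c X) (prune t c Y))
      selected left  = pruned-fixed left X (size-prune-branch left c X Y p)
      selected right = pruned-fixed right Y (size-prune-branch right c X Y p)
    by-cases (no c≢a) = begin
      prune s a (m (node X c Y))                                    ≡⟨ cong (prune s a) (m-node X c Y) ⟩
      prune s a (node (m (prune left c X)) c (m (prune right c Y))) ≡⟨ prune-miss s _ _ c≢a ⟩
      node (prune s a (m (prune left c X))) c (prune s a (m (prune right c Y)))
        ≡⟨ cong₂ (λ U V → node U c V) (prune-m-comm-≤ s a n _ (size-prune-branch left c X Y p))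
                                       (prune-m-comm-≤ s a n _ (size-prune-branch right c X Y p)) ⟩
      node (m (prune s a (prune left c X))) c (m (prune s a (prune right c Y)))
        ≡⟨ cong₂ (λ U V → node (m U) c (m V)) (prune-comm s left (≢-sym c≢a) X) (prune-comm s right (≢-sym c≢a) Y) ⟩
      node (m (prune left c (prune s a X))) c (m (prune right c (prune s a Y))) ≡⟨ m-node (prune s a X) c (prune s a Y) ⟨
      m (node (prune s a X) c (prune s a Y))                        ≡⟨ cong m (prune-miss s X Y c≢a) ⟨
      m (prune s a (node X c Y))                                    ∎

  prune-m-comm : ∀ s a X → prune s a (m X) ≡ m (prune s a X)
  prune-m-comm s a X = prune-m-comm-≤ s a _ X ≤-refl

  replace-identity : ∀ X → X [T↦ T ,F↦ F ] ≡ X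
  replace-identity T = refl
  replace-identity F = refl
  replace-identity (node X a Y) = cong₂ (λ U V → node U a V) (replace-identity X) (replace-identity Y)

  m-replace-m-tree-≤ : ∀ n X → size X ≤ n → ∀ Y Z → m (m X [T↦ Y ,F↦ Z ]) ≡ m (X [T↦ Y ,F↦ Z ])
  m-replace-m-tree-≤ n T p Y Z = refl
  m-replace-m-tree-≤ n F p Y Z = refl
  m-replace-m-tree-≤ (suc n) (node X c X') (s≤s p) Y Z = begin
    m (σ (m (node X c X')))                                  ≡⟨ cong (λ W → m (σ W)) (m-node X c X') ⟩
    m (node (σ (m (prune left c X))) c (σ (m (prune right c X'))))
      ≡⟨ m-node-cong (σ (m (prune left c X))) c (σ (m (prune right c X'))) (σ X) (σ X')
                     (step left X (size-prune-branch left c X X' p)) (step right X' (size-prune-branch right c X X' p)) ⟩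
    m (σ (node X c X'))                                      ∎
    where
    σ : Tree → Tree
    σ W = W [T↦ Y ,F↦ Z ]
    step : ∀ s W → size (prune s c W) ≤ n → m (prune s c (σ (m (prune s c W)))) ≡ m (prune s c (σ W))
    step s W q = begin
      m (prune s c (σ (m (prune s c W))))                                ≡⟨ cong m (prune-replace s c (m (prune s c W)) Y Z) ⟩
      m (prune s c (m (prune s c W)) [T↦ prune s c Y ,F↦ prune s c Z ])  ≡⟨ cong (λ U → m (U [T↦ prune s c Y ,F↦ prune s c Z ])) (prune-m-comm s c (prune s c W)) ⟩
      m (m (prune s c (prune s c W)) [T↦ prune s c Y ,F↦ prune s c Z ])  ≡⟨ cong (λ U → m (m U [T↦ prune s c Y ,F↦ prune s c Z ])) (prune-idem s c W) ⟩
      m (m (prune s c W) [T↦ prune s c Y ,F↦ prune s c Z ])              ≡⟨ m-replace-m-tree-≤ n (prune s c W) q _ _ ⟩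
      m (prune s c W [T↦ prune s c Y ,F↦ prune s c Z ])                  ≡⟨ cong m (prune-replace s c W Y Z) ⟨
      m (prune s c (σ W))                                                ∎

  m-replace-m-tree : ∀ X Y Z → m (m X [T↦ Y ,F↦ Z ]) ≡ m (X [T↦ Y ,F↦ Z ])
  m-replace-m-tree X = m-replace-m-tree-≤ _ X ≤-refl

  m-idem : ∀ X → m (m X) ≡ m X
  m-idem X = begin
    m (m X)                    ≡⟨ cong m (replace-identity (m X)) ⟨
    m (m X [T↦ T ,F↦ F ])      ≡⟨ m-replace-m-tree X T F ⟩
    m (X [T↦ T ,F↦ F ])        ≡⟨ cong m (replace-identity X) ⟩
    m X                        ∎

  m-replace-m-leaves-≤ : ∀ n X → size X ≤ n → ∀ Y Z → m (X [T↦ m Y ,F↦ m Z ]) ≡ m (X [T↦ Y ,F↦ Z ])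
  m-replace-m-leaves-≤ n T p Y Z = m-idem Y
  m-replace-m-leaves-≤ n F p Y Z = m-idem Z
  m-replace-m-leaves-≤ (suc n) (node X c X') (s≤s p) Y Z =
    m-node-cong (σₘ X) c (σₘ X') (σ X) (σ X') (step left X (size-prune-branch left c X X' p)) (step right X' (size-prune-branch right c X X' p))
    where
    σ σₘ : Tree → Tree
    σ  W = W [T↦ Y ,F↦ Z ]
    σₘ W = W [T↦ m Y ,F↦ m Z ]
    step : ∀ s W → size (prune s c W) ≤ n → m (prune s c (σₘ W)) ≡ m (prune s c (σ W))
    step s W q = begin
      m (prune s c (σₘ W))                                         ≡⟨ cong m (prune-replace s c W _ _) ⟩
      m (prune s c W [T↦ prune s c (m Y) ,F↦ prune s c (m Z) ])    ≡⟨ cong₂ (λ U V → m (prune s c W [T↦ U ,F↦ V ])) (prune-m-comm s c Y) (prune-m-comm s c Z) ⟩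
      m (prune s c W [T↦ m (prune s c Y) ,F↦ m (prune s c Z) ])    ≡⟨ m-replace-m-leaves-≤ n (prune s c W) q _ _ ⟩
      m (prune s c W [T↦ prune s c Y ,F↦ prune s c Z ])            ≡⟨ cong m (prune-replace s c W Y Z) ⟨
      m (prune s c (σ W))                                          ∎

  m-replace-m-leaves : ∀ X Y Z → m (X [T↦ m Y ,F↦ m Z ]) ≡ m (X [T↦ Y ,F↦ Z ])
  m-replace-m-leaves X = m-replace-m-leaves-≤ _ X ≤-refl

  m-replace-cong : ∀ {X X' Y Y' Z Z'} → m X ≡ m X' → m Y ≡ m Y' → m Z ≡ m Z' →
                   m (X [T↦ Y ,F↦ Z ]) ≡ m (X' [T↦ Y' ,F↦ Z' ])
  m-replace-cong {X} {X'} {Y} {Y'} {Z} {Z'} eqX eqY eqZ = begin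
    m (X [T↦ Y ,F↦ Z ])              ≡⟨ m-replace-m-leaves X Y Z ⟨
    m (X [T↦ m Y ,F↦ m Z ])          ≡⟨ m-replace-m-tree X _ _ ⟨
    m (m X [T↦ m Y ,F↦ m Z ])        ≡⟨ cong₂ (λ U V → m (U [T↦ V ,F↦ m Z ])) eqX eqY ⟩
    m (m X' [T↦ m Y' ,F↦ m Z ])      ≡⟨ cong (λ W → m (m X' [T↦ m Y' ,F↦ W ])) eqZ ⟩
    m (m X' [T↦ m Y' ,F↦ m Z' ])     ≡⟨ m-replace-m-tree X' _ _ ⟩
    m (X' [T↦ m Y' ,F↦ m Z' ])       ≡⟨ m-replace-m-leaves X' Y' Z' ⟩
    m (X' [T↦ Y' ,F↦ Z' ])           ∎

  =mfe-isCongruence : IsCongruence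
  =mfe-isCongruence = record { refl = refl ; sym = sym ; trans = trans } ,
    λ eqP eqQ → m-replace-cong eqP refl refl
              , m-replace-cong eqP eqQ (m-replace-cong eqQ refl refl)
              , m-replace-cong eqP (m-replace-cong eqQ refl refl) eqQ

lemma4p4 : (A : Set) (code : A → ℕ) (code-inj : Injective _≡_ _≡_ code) →
           Atoms.IsCongruence A code code-inj
lemma4p4 = =mfe-isCongruence
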